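{- For every integer $k \ge 2$, $f(2,k) = \frac{k}{2^{k-1}}$.
   Context: For an integer $s\ge 1$ let $\Sigma_s=\{0,1,\ldots,s-1\}$ with its natural total order. An $n$-word over $\Sigma_s$ is a sequence $w=(w_1,\ldots,w_n)\in(\Sigma_s)^n$. A subword is a subsequence $w_{i_1}w_{i_2}\cdots w_{i_k}$ with $i_1<\cdots<i_k$ (subsequences at different position sets are counted as different); it is monotone if it is non-decreasing or non-increasing. Let $m(k,w)$ be the number of monotone $k$-subwords of $w$, let $f(s,k,n)=\min_{w\in(\Sigma_s)^n} m(k,w)/\binom{n}{k}$, and let $f(s,k)=\lim_{n\to\infty} f(s,k,n)$ (this limit exists). -}

module Defs where

open import Data.Nat using (ℕ; zero; suc; _≤ᵇ_)
open import Data.Nat.Combinatorics using (_C_)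
open import Data.Bool using (Bool; true; false; _∧_; _∨_)
open import Data.Fin using (Fin; toℕ)
open import Data.Vec using (Vec; []; _∷_; toList)
open import Data.List using (List; []; _∷_; map; _++_; filter; length; foldr; concatMap; allFin)
open import Data.Integer using (+_)
open import Data.Rational using (ℚ; _/_; _⊓_; 0ℚ)
open import Relation.Nullary.Decidable using (yes; no)
open import Relation.Binary.PropositionalEquality using (_≡_)
open import Data.Bool using (_≟_)

Word : ℕ → ℕ → Set
Word s n = Vec (Fin s) n

-- All k-subsequences of a list, one per set of positions (so counted with
-- multiplicity, as in the paper).
subseqs : {A : Set} → ℕ → List A → List (List A)
subseqs zero    _        = [] ∷ []
subseqs (suc k) []       = []
subseqs (suc k) (x ∷ xs) = map (x ∷_) (subseqs k xs) ++ subseqs (suc k) xs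

nonDecreasing : {s : ℕ} → List (Fin s) → Bool
nonDecreasing []           = true
nonDecreasing (x ∷ [])     = true
nonDecreasing (x ∷ y ∷ xs) = (toℕ x ≤ᵇ toℕ y) ∧ nonDecreasing (y ∷ xs)

nonIncreasing : {s : ℕ} → List (Fin s) → Bool
nonIncreasing []           = true
nonIncreasing (x ∷ [])     = true
nonIncreasing (x ∷ y ∷ xs) = (toℕ y ≤ᵇ toℕ x) ∧ nonIncreasing (y ∷ xs)

monotone : {s : ℕ} → List (Fin s) → Bool
monotone u = nonDecreasing u ∨ nonIncreasing u

m : {s n : ℕ} → ℕ → Word s n → ℕ
m k w = length (filter (λ u → monotone u ≟ true) (subseqs k (toList w)))

allWords : (s n : ℕ) → List (Word s n)
allWords s zero    = [] ∷ []
allWords s (suc n) = concatMap (λ a → map (a ∷_) (allWords s n)) (allFin s)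

-- a / b as a rational; the value for b = 0 is an irrelevant convention
-- (binom n k = 0 only for n < k, irrelevant for the limit n → ∞).
ratio : ℕ → ℕ → ℚ
ratio a zero    = 0ℚ
ratio a (suc b) = (+ a) / suc b

-- minimum of a list of rationals (default 0 on the empty list, which never
-- occurs for s ≥ 1)
minimumℚ : List ℚ → ℚ
minimumℚ []       = 0ℚ
minimumℚ (x ∷ xs) = foldr _⊓_ x xs

f : ℕ → ℕ → ℕ → ℚ
f s k n = minimumℚ (map (λ w → ratio (m k w) (n C k)) (allWords s n))

-- A monotone subword of length k ≥ 2 of a binary word is either nondecreasing and contains
-- a 0, or nonincreasing and contains a 1, and not both. Classifying it by its last 0, resp.
-- its last 1, at position i gives m(k, w) = Σᵢ C(cᵢ, k − 1), where the degree cᵢ counts the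
-- letters equal to wᵢ before i and different from wᵢ after i; moreover Σᵢ cᵢ = C(n, 2).
-- By convexity of C(·, k − 1) every word has m(k, w) ≥ n C(⌊(n − 1)/2⌋, k − 1), while all
-- degrees of the alternating word 0101… are at most ⌊n/2⌋. As C(n, k) = (n/k) C(n − 1, k − 1)
-- and C(n/2, k − 1) / C(n − 1, k − 1) → 2^−(k−1), both bounds divided by C(n, k) tend to
-- k / 2^(k−1).
module Submission where

open import Defs
open import Data.Bool using (Bool; true; false; _≟_)
open import Data.Bool.Properties using (∨-identityʳ)
open import Data.Fin using (Fin; zero; suc; opposite)
open import Data.Integer as ℤ using (+_; +[1+_]; -[1+_])
import Data.Integer.Properties as ℤP
open import Data.List using (List; []; _∷_; map; _++_; filter; length)
open import Data.List.Properties using (length-++; filter-++; filter-≐; map-++; map-∘; foldr-preservesᵇ)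
open import Data.List.Membership.Propositional using (_∈_)
open import Data.List.Membership.Propositional.Properties using (∈-map⁺; ∈-concatMap⁺; ∈-allFin)
open import Data.List.Relation.Unary.All using (All; []; _∷_; universal)
open import Data.List.Relation.Unary.All.Properties using (map⁺)
open import Data.List.Relation.Unary.Any as Any using (here; there)
open import Data.Nat using (ℕ; zero; suc; _+_; _*_; _^_; _∸_; _≤_; _≤′_; ≤′-refl; ≤′-step; z≤n; s≤s;
                            pred; ⌊_/2⌋; ⌈_/2⌉; NonZero; >-nonZero)
open import Data.Nat.Combinatorics using (_C_; nCk+nC[k+1]≡[n+1]C[k+1])
open import Data.Nat.ListAction using (sum)
open import Data.Nat.Properties hiding (_≟_)
open import Data.Nat.Tactic.RingSolver using (solve-∀)
open import Algebra.Properties.CommutativeSemigroup +-commutativeSemigroup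
  using () renaming (x∙yz≈y∙xz to x+[y+z]≡y+[x+z])
open import Algebra.Properties.CommutativeSemigroup *-commutativeSemigroup
  using () renaming (x∙yz≈y∙xz to x*[y*z]≡y*[x*z])
open import Data.Product using (_,_; ∃-syntax)
open import Data.Rational as ℚ using (ℚ; mkℚ; _/_; _-_; ∣_∣; _<_; 0ℚ; toℚᵘ)
import Data.Rational.Properties as ℚP
open import Data.Rational.Unnormalised as ℚᵘ using (mkℚᵘ; *≤*; *<*)
import Data.Rational.Unnormalised.Properties as ℚᵘP
open import Data.Sum using (inj₁; inj₂)
open import Data.Vec using (Vec; []; _∷_; toList)
open import Data.Vec.Properties using (length-toList)
open import Function using (_∘_)
open import Relation.Binary.PropositionalEquality
open import Algebra.Properties.AbelianGroup ℚP.+-0-abelianGroup using (xyx⁻¹≈y; ⁻¹-anti-homo‿-)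

-- Binomial coefficients

infix 8 _choose_

_choose_ : ℕ → ℕ → ℕ
n     choose zero  = 1
zero  choose suc k = 0
suc n choose suc k = n choose k + n choose suc k

choose≡C : ∀ n k → n choose k ≡ n C k
choose≡C n       zero    = refl
choose≡C zero    (suc k) = refl
choose≡C (suc n) (suc k) =
  trans (cong₂ _+_ (choose≡C n k) (choose≡C n (suc k))) (nCk+nC[k+1]≡[n+1]C[k+1] n k)

Σchoose : List ℕ → ℕ → ℕ
Σchoose []       r = 0
Σchoose (d ∷ ds) r = d choose r + Σchoose ds r

Σchoose-map-suc : ∀ ds r → Σchoose (map suc ds) (suc r) ≡ Σchoose ds (suc r) + Σchoose ds r
Σchoose-map-suc []       r = refl
Σchoose-map-suc (d ∷ ds) r rewrite Σchoose-map-suc ds r =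
  shuffle (d choose r) (d choose suc r) (Σchoose ds (suc r)) (Σchoose ds r)
  where
  shuffle : ∀ a b c e → (a + b) + (c + e) ≡ (b + c) + (a + e)
  shuffle = solve-∀

Σchoose₀-map-suc : ∀ ds → Σchoose (map suc ds) 0 ≡ Σchoose ds 0
Σchoose₀-map-suc []       = refl
Σchoose₀-map-suc (d ∷ ds) = cong suc (Σchoose₀-map-suc ds)

choose-1 : ∀ n → n choose 1 ≡ n
choose-1 zero    = refl
choose-1 (suc n) = cong suc (choose-1 n)

choose-absorb : ∀ n k → suc k * suc n choose suc k ≡ suc n * n choose k
choose-absorb zero    zero    = refl
choose-absorb zero    (suc k) = *-zeroʳ (suc (suc k))
choose-absorb (suc n) zero    = trans (+-identityʳ _) (trans (cong suc (choose-1 (suc n))) (sym (*-identityʳ _)))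
choose-absorb (suc n) (suc k) = begin
  suc (suc k) * (a + b)                          ≡⟨ split (suc k) a b ⟩
  suc k * a + a + suc (suc k) * b                ≡⟨ cong₂ (λ u v → u + a + v) (choose-absorb n k) (choose-absorb n (suc k)) ⟩
  suc n * n choose k + a + suc n * n choose suc k ≡⟨ merge (suc n) (n choose k) (n choose suc k) a ⟩
  suc n * (n choose k + n choose suc k) + a      ≡⟨ +-comm (suc n * a) a ⟩
  suc (suc n) * a                                ∎
  where
  open ≡-Reasoning
  a = suc n choose suc k
  b = suc n choose suc (suc k)
  split : ∀ k a b → suc k * (a + b) ≡ k * a + a + suc k * b
  split = solve-∀
  merge : ∀ m p q a → m * p + a + m * q ≡ m * (p + q) + a
  merge = solve-∀

choose-mono-suc : ∀ n k → n choose k ≤ suc n choose k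
choose-mono-suc n zero    = ≤-refl
choose-mono-suc n (suc k) = m≤n+m (n choose suc k) (n choose k)

choose-monoˡ-≤ : ∀ {m n} k → m ≤ n → m choose k ≤ n choose k
choose-monoˡ-≤ {m} k m≤n = go (≤⇒≤′ m≤n)
  where
  go : ∀ {n} → m ≤′ n → m choose k ≤ n choose k
  go ≤′-refl       = ≤-refl
  go (≤′-step m≤n) = ≤-trans (go m≤n) (choose-mono-suc _ k)

1≤choose : ∀ {n k} → k ≤ n → 1 ≤ n choose k
1≤choose {n}     {zero}  _         = s≤s z≤n
1≤choose {suc n} {suc k} (s≤s k≤n) = ≤-trans (1≤choose k≤n) (m≤m+n (n choose k) (n choose suc k))

choose-growth-≥ : ∀ a d R → a choose suc R + d * a choose R ≤ (a + d) choose suc R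
choose-growth-≥ a zero    R rewrite +-identityʳ a | +-identityʳ (a choose suc R) = ≤-refl
choose-growth-≥ a (suc d) R rewrite +-suc a d = begin
  a choose suc R + (a choose R + d * a choose R) ≡⟨ x+[y+z]≡y+[x+z] (a choose suc R) (a choose R) _ ⟩
  a choose R + (a choose suc R + d * a choose R) ≤⟨ +-mono-≤ (choose-monoˡ-≤ R (m≤m+n a d)) (choose-growth-≥ a d R) ⟩
  (a + d) choose R + (a + d) choose suc R         ∎
  where open ≤-Reasoning

choose-growth-≤ : ∀ x d R → (x + d) choose suc R ≤ x choose suc R + d * (x + d) choose R
choose-growth-≤ x zero    R rewrite +-identityʳ x | +-identityʳ (x choose suc R) = ≤-refl
choose-growth-≤ x (suc d) R rewrite +-suc x d = begin
  y choose R + y choose suc R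
    ≤⟨ +-mono-≤ (choose-mono-suc y R) (choose-growth-≤ x d R) ⟩
  suc y choose R + (x choose suc R + d * y choose R)
    ≤⟨ +-monoʳ-≤ (suc y choose R) (+-monoʳ-≤ (x choose suc R) (*-monoʳ-≤ d (choose-mono-suc y R))) ⟩
  suc y choose R + (x choose suc R + d * suc y choose R)
    ≡⟨ x+[y+z]≡y+[x+z] (suc y choose R) (x choose suc R) _ ⟩
  x choose suc R + (suc y choose R + d * suc y choose R) ∎
  where
  open ≤-Reasoning
  y = x + d

-- The tangent line of C(·, R + 1) at a lies below it: C(x, R + 1) ≥ C(a, R + 1) + (x − a) C(a, R),
-- rearranged to avoid truncated subtraction.
choose-tangent : ∀ a x R → a choose suc R + x * a choose R ≤ x choose suc R + a * a choose R
choose-tangent a x R with ≤-total a x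
... | inj₁ a≤x with x ∸ a | m+[n∸m]≡n a≤x
...   | d | refl = begin
  a choose suc R + (a + d) * a choose R           ≡⟨ split (a choose suc R) a d (a choose R) ⟩
  (a choose suc R + d * a choose R) + a * a choose R ≤⟨ +-monoˡ-≤ _ (choose-growth-≥ a d R) ⟩
  (a + d) choose suc R + a * a choose R           ∎
  where
  open ≤-Reasoning
  split : ∀ p a d q → p + (a + d) * q ≡ (p + d * q) + a * q
  split = solve-∀
choose-tangent a x R | inj₂ x≤a with a ∸ x | m+[n∸m]≡n x≤a
...   | d | refl = begin
  (x + d) choose suc R + x * c                    ≤⟨ +-monoˡ-≤ _ (choose-growth-≤ x d R) ⟩
  (x choose suc R + d * c) + x * c                ≡⟨ merge (x choose suc R) x d c ⟩
  x choose suc R + (x + d) * c                    ∎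
  where
  open ≤-Reasoning
  c = (x + d) choose R
  merge : ∀ p x d q → (p + d * q) + x * q ≡ p + (x + d) * q
  merge = solve-∀

choose-jensen : ∀ a R (cs : List ℕ) → a * length cs ≤ sum cs →
                length cs * a choose suc R ≤ Σchoose cs (suc R)
choose-jensen a R cs a·n≤Σcs = +-cancelʳ-≤ (sum cs * a choose R) _ _ (begin
  length cs * a choose suc R + sum cs * a choose R ≤⟨ tangents cs ⟩
  Σchoose cs (suc R) + length cs * (a * a choose R) ≡⟨ cong (λ t → Σchoose cs (suc R) + t) (reorder (length cs) a (a choose R)) ⟩
  Σchoose cs (suc R) + a * length cs * a choose R   ≤⟨ +-monoʳ-≤ _ (*-monoˡ-≤ (a choose R) a·n≤Σcs) ⟩
  Σchoose cs (suc R) + sum cs * a choose R          ∎)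
  where
  open ≤-Reasoning
  reorder : ∀ n a c → n * (a * c) ≡ a * n * c
  reorder = solve-∀
  tangents : ∀ cs → length cs * a choose suc R + sum cs * a choose R ≤ Σchoose cs (suc R) + length cs * (a * a choose R)
  tangents []       = ≤-refl
  tangents (c ∷ cs) = begin
    (t + length cs * t) + (c + sum cs) * s
      ≡⟨ split t (length cs * t) c (sum cs) s ⟩
    (t + c * s) + (length cs * t + sum cs * s)
      ≤⟨ +-mono-≤ (choose-tangent a c R) (tangents cs) ⟩
    (c choose suc R + a * s) + (Σchoose cs (suc R) + length cs * (a * s))
      ≡⟨ merge (c choose suc R) (a * s) (Σchoose cs (suc R)) (length cs) ⟩
    (c choose suc R + Σchoose cs (suc R)) + (a * s + length cs * (a * s)) ∎
    where
    t = a choose suc R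
    s = a choose R
    split : ∀ p q c σ b → (p + q) + (c + σ) * b ≡ (p + c * b) + (q + σ * b)
    split = solve-∀
    merge : ∀ p q σ n → (p + q) + (σ + n * q) ≡ (p + σ) + (q + n * q)
    merge = solve-∀

Σchoose-≤ : ∀ K R (cs : List ℕ) → All (_≤ K) cs → Σchoose cs R ≤ length cs * K choose R
Σchoose-≤ K R []       []           = z≤n
Σchoose-≤ K R (c ∷ cs) (c≤K ∷ cs≤K) = +-mono-≤ (choose-monoˡ-≤ R c≤K) (Σchoose-≤ K R cs cs≤K)

2*⌊n/2⌋≤n : ∀ n → 2 * ⌊ n /2⌋ ≤ n
2*⌊n/2⌋≤n n = begin
  2 * ⌊ n /2⌋            ≡⟨ cong (λ t → ⌊ n /2⌋ + t) (+-identityʳ ⌊ n /2⌋) ⟩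
  ⌊ n /2⌋ + ⌊ n /2⌋      ≤⟨ +-monoʳ-≤ ⌊ n /2⌋ (⌊n/2⌋≤⌈n/2⌉ n) ⟩
  ⌊ n /2⌋ + ⌈ n /2⌉      ≡⟨ ⌊n/2⌋+⌈n/2⌉≡n n ⟩
  n                      ∎
  where open ≤-Reasoning

⌈n/2⌉≤1+⌊n/2⌋ : ∀ n → ⌈ n /2⌉ ≤ suc ⌊ n /2⌋
⌈n/2⌉≤1+⌊n/2⌋ n = ⌊n/2⌋-mono (n≤1+n (suc n))

n≤2*⌊n/2⌋+1 : ∀ n → n ≤ 2 * ⌊ n /2⌋ + 1
n≤2*⌊n/2⌋+1 n = begin
  n                              ≡⟨ sym (⌊n/2⌋+⌈n/2⌉≡n n) ⟩
  ⌊ n /2⌋ + ⌈ n /2⌉              ≤⟨ +-monoʳ-≤ ⌊ n /2⌋ (⌈n/2⌉≤1+⌊n/2⌋ n) ⟩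
  ⌊ n /2⌋ + suc ⌊ n /2⌋          ≡⟨ +-suc ⌊ n /2⌋ ⌊ n /2⌋ ⟩
  suc (⌊ n /2⌋ + ⌊ n /2⌋)        ≡⟨ +-comm 1 (⌊ n /2⌋ + ⌊ n /2⌋) ⟩
  ⌊ n /2⌋ + ⌊ n /2⌋ + 1          ≡⟨ cong (λ h → ⌊ n /2⌋ + h + 1) (sym (+-identityʳ ⌊ n /2⌋)) ⟩
  2 * ⌊ n /2⌋ + 1                ∎
  where open ≤-Reasoning

choose-halving : ∀ R {x y} → 2 * x ≤ y → 2 ^ R * x choose R ≤ y choose R
choose-halving zero                      _ = ≤-refl
choose-halving (suc R) {zero}            _ = ≤-trans (≤-reflexive (*-zeroʳ (2 ^ suc R))) z≤n
choose-halving (suc R) {suc x} {zero}    h with () ← subst (_≤ 0) (*-suc 2 x) h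
choose-halving (suc R) {suc x} {suc y}   h = *-cancelˡ-≤ (suc R) (begin
  suc R * (2 * p * suc x choose suc R)  ≡⟨ x*[y*z]≡y*[x*z] (suc R) (2 * p) (suc x choose suc R) ⟩
  2 * p * (suc R * suc x choose suc R)  ≡⟨ cong (2 * p *_) (choose-absorb x R) ⟩
  2 * p * (suc x * x choose R)          ≡⟨ regroup p (suc x) (x choose R) ⟩
  2 * suc x * (p * x choose R)          ≤⟨ *-mono-≤ h (choose-halving R (<⇒≤ (≤-pred h'))) ⟩
  suc y * y choose R                    ≡⟨ sym (choose-absorb y R) ⟩
  suc R * suc y choose suc R            ∎)
  where
  open ≤-Reasoning
  p = 2 ^ R
  h' : suc (suc (2 * x)) ≤ suc y
  h' = subst (_≤ suc y) (*-suc 2 x) h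
  regroup : ∀ p s c → 2 * p * (s * c) ≡ 2 * s * (p * c)
  regroup = solve-∀

choose-halving-upper : ∀ R {x y} → 2 * x ≤ suc y → 2 ^ suc R * x choose suc R * y ≤ y choose suc R * suc y
choose-halving-upper R {zero}  {y}     _ = ≤-trans (≤-reflexive (cong (_* y) (*-zeroʳ (2 ^ suc R)))) z≤n
choose-halving-upper R {suc x} {zero}  h with () ← ≤-pred (subst (_≤ 1) (*-suc 2 x) h)
choose-halving-upper R {suc x} {suc y} h = *-cancelˡ-≤ (suc R) (begin
  suc R * (2 * p * suc x choose suc R * suc y)   ≡⟨ regroup (suc R) p (suc x choose suc R) (suc y) ⟩
  2 * p * (suc R * suc x choose suc R) * suc y   ≡⟨ cong (λ c → 2 * p * c * suc y) (choose-absorb x R) ⟩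
  2 * p * (suc x * x choose R) * suc y           ≡⟨ regroup′ p (suc x) (x choose R) (suc y) ⟩
  2 * suc x * (p * x choose R) * suc y           ≤⟨ *-monoˡ-≤ (suc y) (*-mono-≤ h (choose-halving R 2x≤y)) ⟩
  suc (suc y) * y choose R * suc y               ≡⟨ regroup″ (suc (suc y)) (y choose R) (suc y) ⟩
  suc y * y choose R * suc (suc y)               ≡⟨ cong (_* suc (suc y)) (sym (choose-absorb y R)) ⟩
  suc R * suc y choose suc R * suc (suc y)       ≡⟨ *-assoc (suc R) (suc y choose suc R) (suc (suc y)) ⟩
  suc R * (suc y choose suc R * suc (suc y))     ∎)
  where
  open ≤-Reasoning
  p = 2 ^ R
  2x≤y : 2 * x ≤ y
  2x≤y = ≤-pred (≤-pred (subst (_≤ suc (suc y)) (*-suc 2 x) h))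
  regroup : ∀ r p c y → r * (2 * p * c * y) ≡ 2 * p * (r * c) * y
  regroup = solve-∀
  regroup′ : ∀ p s c y → 2 * p * (s * c) * y ≡ 2 * s * (p * c) * y
  regroup′ = solve-∀
  regroup″ : ∀ a c b → a * c * b ≡ b * c * a
  regroup″ = solve-∀

halving-lower-step : ∀ {a b s c Y P R} → a ≤ b + s → P ≤ c * a → c * Y ≤ P + c * (R * (suc s + R)) →
                     a * (c * Y) ≤ b * P + a * c * (suc R * (s + suc R))
halving-lower-step {a} {b} {s} {c} {Y} {P} {R} a≤b+s P≤c·a ih = begin
  a * (c * Y)                       ≤⟨ *-monoʳ-≤ a ih ⟩
  a * (P + c * e)                   ≡⟨ *-distribˡ-+ a P (c * e) ⟩
  a * P + a * (c * e)               ≤⟨ +-monoˡ-≤ (a * (c * e)) (*-monoˡ-≤ P a≤b+s) ⟩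
  (b + s) * P + a * (c * e)         ≡⟨ split b s P a c e ⟩
  b * P + (s * P + a * c * e)       ≤⟨ +-monoʳ-≤ (b * P) (+-monoˡ-≤ (a * c * e) (*-monoʳ-≤ s P≤c·a)) ⟩
  b * P + (s * (c * a) + a * c * e) ≡⟨ cong (_+_ (b * P)) (factor s c a e) ⟩
  b * P + a * c * (s + e)           ≤⟨ +-monoʳ-≤ (b * P) (*-monoʳ-≤ (a * c) (m≤m+n (s + e) (suc R))) ⟩
  b * P + a * c * (s + e + suc R)   ≡⟨ cong (λ t → b * P + a * c * t) (collect s R) ⟩
  b * P + a * c * (suc R * (s + suc R)) ∎
  where
  open ≤-Reasoning
  e = R * (suc s + R)
  split : ∀ b s P a c e → (b + s) * P + a * (c * e) ≡ b * P + (s * P + a * c * e)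
  split = solve-∀
  factor : ∀ s c a e → s * (c * a) + a * c * e ≡ a * c * (s + e)
  factor = solve-∀
  collect : ∀ s R → s + R * (suc s + R) + suc R ≡ suc R * (s + suc R)
  collect = solve-∀

-- A Weierstrass-type product inequality: halving x against y costs at most the
-- relative error R (s + R) / Y, where s is the slack in y ≤ 2x + s.
choose-halving-lower : ∀ R {x y s Y} → 2 * x ≤ y → y ≤ 2 * x + s → Y + R ≤ y →
  y choose R * Y ≤ 2 ^ R * x choose R * Y + y choose R * (R * (s + R))
choose-halving-lower zero {Y = Y} _ _ _ = m≤m+n (1 * Y) 0
choose-halving-lower (suc R) {y = zero} _ _ _ = z≤n
choose-halving-lower (suc R) {zero} {suc y} {s} {Y} _ y≤s Y+R≤y = begin
  c * Y                                          ≤⟨ *-monoʳ-≤ c Y≤error ⟩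
  c * (suc R * (s + suc R))                      ≡⟨ cong (λ z → z * Y + c * (suc R * (s + suc R))) (sym (*-zeroʳ (2 ^ suc R))) ⟩
  2 ^ suc R * 0 * Y + c * (suc R * (s + suc R))  ∎
  where
  open ≤-Reasoning
  c = suc y choose suc R
  Y≤error : Y ≤ suc R * (s + suc R)
  Y≤error = ≤-trans (m≤m+n Y (suc R)) (≤-trans Y+R≤y (≤-trans y≤s (≤-trans (m≤m+n s (suc R)) (m≤n*m _ (suc R)))))
choose-halving-lower (suc R) {suc x} {suc y} {s} {Y} 2x≤y y≤2x+s Y+R≤y = *-cancelˡ-≤ (suc R) (begin
  suc R * (suc y choose suc R * Y)           ≡⟨ sym (*-assoc (suc R) (suc y choose suc R) Y) ⟩
  suc R * suc y choose suc R * Y             ≡⟨ cong (_* Y) (choose-absorb y R) ⟩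
  suc y * c * Y                              ≡⟨ *-assoc (suc y) c Y ⟩
  suc y * (c * Y)                            ≤⟨ halving-lower-step {c = c} {Y} {P} {R} y≤2x+s P≤c·y ih ⟩
  2 * suc x * P + suc y * c * K              ≡⟨ regroup p (suc x) (x choose R) Y (suc y * c * K) ⟩
  2 * p * (suc x * x choose R) * Y + suc y * c * K
    ≡⟨ cong₂ (λ u v → 2 * p * u * Y + v * K) (sym (choose-absorb x R)) (sym (choose-absorb y R)) ⟩
  2 * p * (suc R * suc x choose suc R) * Y + suc R * suc y choose suc R * K
    ≡⟨ distribute (suc R) p (suc x choose suc R) Y (suc y choose suc R) K ⟩
  suc R * (2 ^ suc R * suc x choose suc R * Y + suc y choose suc R * K) ∎)
  where
  open ≤-Reasoning
  c = y choose R
  p = 2 ^ R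
  P = p * x choose R * Y
  K = suc R * (s + suc R)
  2x≤y′ : 2 * x ≤ y
  2x≤y′ = <⇒≤ (≤-pred (subst (_≤ suc y) (*-suc 2 x) 2x≤y))
  ih : c * Y ≤ P + c * (R * (suc s + R))
  ih = choose-halving-lower R 2x≤y′ (≤-pred (subst (suc y ≤_) (shift x s) y≤2x+s))
                              (≤-pred (subst (_≤ suc y) (+-suc Y R) Y+R≤y))
    where
    shift : ∀ x s → 2 * suc x + s ≡ suc (2 * x + suc s)
    shift = solve-∀
  P≤c·y : P ≤ c * suc y
  P≤c·y = *-mono-≤ (choose-halving R 2x≤y′) (≤-trans (m≤m+n Y (suc R)) Y+R≤y)
  regroup : ∀ p a b Y t → 2 * a * (p * b * Y) + t ≡ 2 * p * (a * b) * Y + t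
  regroup = solve-∀
  distribute : ∀ r p a Y b K → 2 * p * (r * a) * Y + r * b * K ≡ r * (2 * p * a * Y + b * K)
  distribute = solve-∀

-- Counting subwords

-- Agrees definitionally with the count in Defs.m.
count : {A : Set} → (A → Bool) → List A → ℕ
count p xs = length (filter (λ x → p x ≟ true) xs)

count-++ : {A : Set} (p : A → Bool) (xs ys : List A) → count p (xs ++ ys) ≡ count p xs + count p ys
count-++ p xs ys = trans (cong length (filter-++ (λ x → p x ≟ true) xs ys)) (length-++ (filter _ xs))

count-map : {A B : Set} (p : B → Bool) (f : A → B) (xs : List A) → count p (map f xs) ≡ count (p ∘ f) xs
count-map p f []       = refl
count-map p f (x ∷ xs) with p (f x)
... | true  = cong suc (count-map p f xs)
... | false = count-map p f xs

count-cong : {A : Set} {p q : A → Bool} → (∀ x → p x ≡ q x) → (xs : List A) → count p xs ≡ count q xs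
count-cong {p = p} {q} p≗q xs =
  cong length (filter-≐ (λ x → p x ≟ true) (λ x → q x ≟ true)
                        ((λ {x} px → trans (sym (p≗q x)) px) , (λ {x} qx → trans (p≗q x) qx)) xs)

count-false : {A : Set} (xs : List A) → count (λ _ → false) xs ≡ 0
count-false []       = refl
count-false (x ∷ xs) = count-false xs

subseqs-map : {A B : Set} (f : A → B) (k : ℕ) (xs : List A) →
              subseqs k (map f xs) ≡ map (map f) (subseqs k xs)
subseqs-map f zero    xs       = refl
subseqs-map f (suc k) []       = refl
subseqs-map f (suc k) (x ∷ xs) = begin
  map (f x ∷_) (subseqs k (map f xs)) ++ subseqs (suc k) (map f xs)
    ≡⟨ cong₂ (λ u v → map (f x ∷_) u ++ v) (subseqs-map f k xs) (subseqs-map f (suc k) xs) ⟩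
  map (f x ∷_) (map (map f) (subseqs k xs)) ++ map (map f) (subseqs (suc k) xs)
    -- both sides fuse to map (λ u → f x ∷ map f u) (subseqs k xs)
    ≡⟨ cong (_++ map (map f) (subseqs (suc k) xs)) (trans (sym (map-∘ (subseqs k xs))) (map-∘ (subseqs k xs))) ⟩
  map (map f) (map (x ∷_) (subseqs k xs)) ++ map (map f) (subseqs (suc k) xs)
    ≡⟨ sym (map-++ (map f) (map (x ∷_) (subseqs k xs)) _) ⟩
  map (map f) (map (x ∷_) (subseqs k xs) ++ subseqs (suc k) xs) ∎
  where open ≡-Reasoning

count-subseqs-∷ : {A : Set} (p : List A → Bool) (r : ℕ) (x : A) (xs : List A) →
  count p (subseqs (suc r) (x ∷ xs)) ≡ count (p ∘ (x ∷_)) (subseqs r xs) + count p (subseqs (suc r) xs)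
count-subseqs-∷ p r x xs =
  trans (count-++ p (map (x ∷_) (subseqs r xs)) _) (cong (_+ _) (count-map p (x ∷_) (subseqs r xs)))

-- Monotone subwords of binary words

pattern one = suc zero

Bits : Set
Bits = List (Fin 2)

zeros ones : Bits → ℕ
zeros []       = 0
zeros (zero ∷ u) = suc (zeros u)
zeros (one ∷ u)  = zeros u
ones []        = 0
ones (zero ∷ u) = ones u
ones (one ∷ u)  = suc (ones u)

allOnes : Bits → Bool
allOnes []         = true
allOnes (zero ∷ u) = false
allOnes (one ∷ u)  = allOnes u

nonDecreasing-zero∷ : ∀ (u : Bits) → nonDecreasing (zero ∷ u) ≡ nonDecreasing u
nonDecreasing-zero∷ []      = refl
nonDecreasing-zero∷ (_ ∷ _) = refl

nonDecreasing-one∷ : ∀ (u : Bits) → nonDecreasing (one ∷ u) ≡ allOnes u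
nonDecreasing-one∷ []         = refl
nonDecreasing-one∷ (zero ∷ u) = refl
nonDecreasing-one∷ (one ∷ u)  = nonDecreasing-one∷ u

nonIncreasing-one∷ : ∀ (u : Bits) → nonIncreasing (one ∷ u) ≡ nonIncreasing u
nonIncreasing-one∷ []         = refl
nonIncreasing-one∷ (zero ∷ u) = refl
nonIncreasing-one∷ (one ∷ u)  = refl

monotone-zero∷ : ∀ (u : Bits) → monotone (zero ∷ u) ≡ nonDecreasing u
monotone-zero∷ []         = refl
monotone-zero∷ (zero ∷ u) = trans (monotone-zero∷ u) (sym (nonDecreasing-zero∷ u))
monotone-zero∷ (one ∷ u)  = ∨-identityʳ _

monotone-one∷ : ∀ (u : Bits) → monotone (one ∷ u) ≡ nonIncreasing u
monotone-one∷ []         = refl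
monotone-one∷ (zero ∷ u) = refl
monotone-one∷ (one ∷ u)  = trans (monotone-one∷ u) (sym (nonIncreasing-one∷ u))

nonIncreasing≡nonDecreasing-opposite : ∀ (u : Bits) → nonIncreasing u ≡ nonDecreasing (map opposite u)
nonIncreasing≡nonDecreasing-opposite []      = refl
nonIncreasing≡nonDecreasing-opposite (x ∷ u) = go x u
  where
  go : ∀ x (u : Bits) → nonIncreasing (x ∷ u) ≡ nonDecreasing (map opposite (x ∷ u))
  go x    []         = refl
  go zero (zero ∷ u) = go zero u
  go zero (one ∷ u)  = refl
  go one  (zero ∷ u) = go zero u
  go one  (one ∷ u)  = go one u

zeros-opposite : ∀ (u : Bits) → zeros (map opposite u) ≡ ones u
zeros-opposite []         = refl
zeros-opposite (zero ∷ u) = zeros-opposite u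
zeros-opposite (one ∷ u)  = cong suc (zeros-opposite u)

ones-opposite : ∀ (u : Bits) → ones (map opposite u) ≡ zeros u
ones-opposite []         = refl
ones-opposite (zero ∷ u) = cong suc (ones-opposite u)
ones-opposite (one ∷ u)  = ones-opposite u

#nonDecreasing #monotone : ℕ → Bits → ℕ
#nonDecreasing r L = count nonDecreasing (subseqs r L)
#monotone      r L = count monotone (subseqs r L)

count-allOnes : ∀ r (L : Bits) → count allOnes (subseqs r L) ≡ ones L choose r
count-allOnes zero    L          = refl
count-allOnes (suc r) []         = refl
count-allOnes (suc r) (zero ∷ L) =
  trans (count-subseqs-∷ allOnes r zero L) (cong₂ _+_ (count-false (subseqs r L)) (count-allOnes (suc r) L))
count-allOnes (suc r) (one ∷ L)  =
  trans (count-subseqs-∷ allOnes r one L) (cong₂ _+_ (count-allOnes r L) (count-allOnes (suc r) L))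

count-nonIncreasing : ∀ r (L : Bits) → count nonIncreasing (subseqs r L) ≡ #nonDecreasing r (map opposite L)
count-nonIncreasing r L = begin
  count nonIncreasing (subseqs r L)
    ≡⟨ count-cong nonIncreasing≡nonDecreasing-opposite (subseqs r L) ⟩
  count (nonDecreasing ∘ map opposite) (subseqs r L)
    ≡⟨ sym (count-map nonDecreasing (map opposite) (subseqs r L)) ⟩
  count nonDecreasing (map (map opposite) (subseqs r L))
    ≡⟨ cong (count nonDecreasing) (sym (subseqs-map opposite r L)) ⟩
  #nonDecreasing r (map opposite L) ∎
  where open ≡-Reasoning

-- The degree of a position holding the letter x is the number of x's before it plus the number
-- of letters ≠ x after it; a and b count the 0s and 1s of a prefix preceding the list.
degrees : ℕ → ℕ → Bits → List ℕ
degrees a b []         = []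
degrees a b (zero ∷ L) = a + ones L ∷ degrees (suc a) b L
degrees a b (one ∷ L)  = b + zeros L ∷ degrees a (suc b) L

zeroDegrees : ℕ → Bits → List ℕ
zeroDegrees a []         = []
zeroDegrees a (zero ∷ L) = a + ones L ∷ zeroDegrees (suc a) L
zeroDegrees a (one ∷ L)  = zeroDegrees a L

zeroDegrees-suc : ∀ a (L : Bits) → zeroDegrees (suc a) L ≡ map suc (zeroDegrees a L)
zeroDegrees-suc a []         = refl
zeroDegrees-suc a (zero ∷ L) = cong (suc (a + ones L) ∷_) (zeroDegrees-suc (suc a) L)
zeroDegrees-suc a (one ∷ L)  = zeroDegrees-suc a L

-- A nondecreasing subword is either all ones, or determined by its last 0 together with r letters
-- among the 0s before it and the 1s after it.
#nonDecreasing-formula : ∀ r (L : Bits) →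
  #nonDecreasing (suc r) L ≡ ones L choose suc r + Σchoose (zeroDegrees 0 L) r
#nonDecreasing-formula r []         = refl
#nonDecreasing-formula r (one ∷ L)  = begin
  #nonDecreasing (suc r) (one ∷ L)
    ≡⟨ count-subseqs-∷ nonDecreasing r one L ⟩
  count (nonDecreasing ∘ (one ∷_)) (subseqs r L) + #nonDecreasing (suc r) L
    ≡⟨ cong₂ _+_ (trans (count-cong nonDecreasing-one∷ (subseqs r L)) (count-allOnes r L))
                 (#nonDecreasing-formula r L) ⟩
  ones L choose r + (ones L choose suc r + Σchoose (zeroDegrees 0 L) r)
    ≡⟨ sym (+-assoc (ones L choose r) _ _) ⟩
  suc (ones L) choose suc r + Σchoose (zeroDegrees 0 L) r ∎
  where open ≡-Reasoning
#nonDecreasing-formula r (zero ∷ L) =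
  trans (count-subseqs-∷ nonDecreasing r zero L)
        (trans (cong (_+ #nonDecreasing (suc r) L) (count-cong nonDecreasing-zero∷ (subseqs r L))) (pascal r))
  where
  open ≡-Reasoning
  o = ones L
  zd = zeroDegrees 0 L
  pascal : ∀ r → #nonDecreasing r L + #nonDecreasing (suc r) L
                 ≡ o choose suc r + (o choose r + Σchoose (zeroDegrees 1 L) r)
  pascal zero = begin
    suc (#nonDecreasing 1 L)          ≡⟨ cong suc (#nonDecreasing-formula 0 L) ⟩
    suc (o choose 1 + Σchoose zd 0)   ≡⟨ sym (+-suc (o choose 1) _) ⟩
    o choose 1 + suc (Σchoose zd 0)   ≡⟨ cong (λ s → o choose 1 + suc s) (sym (Σchoose₀-map-suc zd)) ⟩
    o choose 1 + suc (Σchoose (map suc zd) 0)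
                                      ≡⟨ cong (λ ds → o choose 1 + suc (Σchoose ds 0)) (sym (zeroDegrees-suc 0 L)) ⟩
    o choose 1 + suc (Σchoose (zeroDegrees 1 L) 0) ∎
  pascal (suc r) = begin
    #nonDecreasing (suc r) L + #nonDecreasing (suc (suc r)) L
      ≡⟨ cong₂ _+_ (#nonDecreasing-formula r L) (#nonDecreasing-formula (suc r) L) ⟩
    (o choose suc r + Σchoose zd r) + (o choose suc (suc r) + Σchoose zd (suc r))
      ≡⟨ shuffle (o choose suc r) (Σchoose zd r) (o choose suc (suc r)) (Σchoose zd (suc r)) ⟩
    o choose suc (suc r) + (o choose suc r + (Σchoose zd (suc r) + Σchoose zd r))
      ≡⟨ cong (λ s → o choose suc (suc r) + (o choose suc r + s))
              (trans (sym (Σchoose-map-suc zd r)) (cong (λ ds → Σchoose ds (suc r)) (sym (zeroDegrees-suc 0 L)))) ⟩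
    o choose suc (suc r) + (o choose suc r + Σchoose (zeroDegrees 1 L) (suc r)) ∎
    where
    shuffle : ∀ a b c d → (a + b) + (c + d) ≡ c + (a + (d + b))
    shuffle = solve-∀

degrees-opposite : ∀ a b (L : Bits) → degrees a b L ≡ degrees b a (map opposite L)
degrees-opposite a b []         = refl
degrees-opposite a b (zero ∷ L) =
  cong₂ _∷_ (cong (_+_ a) (sym (zeros-opposite L))) (degrees-opposite (suc a) b L)
degrees-opposite a b (one ∷ L)  =
  cong₂ _∷_ (cong (_+_ b) (sym (ones-opposite L))) (degrees-opposite a (suc b) L)

Σchoose-degrees-sucˡ : ∀ r a b (L : Bits) →
  Σchoose (degrees (suc a) b L) (suc r) ≡ Σchoose (degrees a b L) (suc r) + Σchoose (zeroDegrees a L) r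
Σchoose-degrees-sucˡ r a b []         = refl
Σchoose-degrees-sucˡ r a b (zero ∷ L) rewrite Σchoose-degrees-sucˡ r (suc a) b L =
  shuffle ((a + ones L) choose r) ((a + ones L) choose suc r)
          (Σchoose (degrees (suc a) b L) (suc r)) (Σchoose (zeroDegrees (suc a) L) r)
  where
  shuffle : ∀ p q s t → (p + q) + (s + t) ≡ (q + s) + (p + t)
  shuffle = solve-∀
Σchoose-degrees-sucˡ r a b (one ∷ L)  rewrite Σchoose-degrees-sucˡ r a (suc b) L =
  sym (+-assoc ((b + zeros L) choose suc r) _ _)

Σchoose-degrees-sucʳ : ∀ r a b (L : Bits) →
  Σchoose (degrees a (suc b) L) (suc r)
    ≡ Σchoose (degrees a b L) (suc r) + Σchoose (zeroDegrees b (map opposite L)) r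
Σchoose-degrees-sucʳ r a b L
  rewrite degrees-opposite a (suc b) L | degrees-opposite a b L = Σchoose-degrees-sucˡ r b a (map opposite L)

#monotone-formula : ∀ r (L : Bits) → #monotone (suc (suc r)) L ≡ Σchoose (degrees 0 0 L) (suc r)
#monotone-formula r []         = refl
#monotone-formula r (zero ∷ L) = begin
  #monotone (suc (suc r)) (zero ∷ L)
    ≡⟨ count-subseqs-∷ monotone (suc r) zero L ⟩
  count (monotone ∘ (zero ∷_)) (subseqs (suc r) L) + #monotone (suc (suc r)) L
    ≡⟨ cong₂ _+_ (trans (count-cong monotone-zero∷ (subseqs (suc r) L)) (#nonDecreasing-formula r L))
                 (#monotone-formula r L) ⟩
  (ones L choose suc r + Σchoose (zeroDegrees 0 L) r) + Σchoose (degrees 0 0 L) (suc r)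
    ≡⟨ +-assoc (ones L choose suc r) _ _ ⟩
  ones L choose suc r + (Σchoose (zeroDegrees 0 L) r + Σchoose (degrees 0 0 L) (suc r))
    ≡⟨ cong (λ t → ones L choose suc r + t) (trans (+-comm (Σchoose (zeroDegrees 0 L) r) _) (sym (Σchoose-degrees-sucˡ r 0 0 L))) ⟩
  ones L choose suc r + Σchoose (degrees 1 0 L) (suc r) ∎
  where open ≡-Reasoning
#monotone-formula r (one ∷ L)  = begin
  #monotone (suc (suc r)) (one ∷ L)
    ≡⟨ count-subseqs-∷ monotone (suc r) one L ⟩
  count (monotone ∘ (one ∷_)) (subseqs (suc r) L) + #monotone (suc (suc r)) L
    ≡⟨ cong₂ _+_ (trans (count-cong monotone-one∷ (subseqs (suc r) L))
                        (trans (count-nonIncreasing (suc r) L) (#nonDecreasing-formula r (map opposite L))))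
                 (#monotone-formula r L) ⟩
  (ones L' choose suc r + Σchoose (zeroDegrees 0 L') r) + Σchoose (degrees 0 0 L) (suc r)
    ≡⟨ +-assoc (ones L' choose suc r) _ _ ⟩
  ones L' choose suc r + (Σchoose (zeroDegrees 0 L') r + Σchoose (degrees 0 0 L) (suc r))
    ≡⟨ cong₂ _+_ (cong (_choose suc r) (ones-opposite L))
                 (trans (+-comm (Σchoose (zeroDegrees 0 L') r) _) (sym (Σchoose-degrees-sucʳ r 0 0 L))) ⟩
  zeros L choose suc r + Σchoose (degrees 0 1 L) (suc r) ∎
  where
  open ≡-Reasoning
  L' = map opposite L

length-degrees : ∀ a b (L : Bits) → length (degrees a b L) ≡ length L
length-degrees a b []         = refl
length-degrees a b (zero ∷ L) = cong suc (length-degrees (suc a) b L)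
length-degrees a b (one ∷ L)  = cong suc (length-degrees a (suc b) L)

length≡zeros+ones : ∀ (L : Bits) → length L ≡ zeros L + ones L
length≡zeros+ones []         = refl
length≡zeros+ones (zero ∷ L) = cong suc (length≡zeros+ones L)
length≡zeros+ones (one ∷ L)  = trans (cong suc (length≡zeros+ones L)) (sym (+-suc (zeros L) (ones L)))

-- Each pair of positions i < j is counted exactly once: in the degree of j if the letters agree, else in that of i.
sum-degrees : ∀ a b (L : Bits) → sum (degrees a b L) ≡ a * zeros L + b * ones L + length L choose 2
sum-degrees a b [] = sym (cong₂ (λ u v → u + v + 0) (*-zeroʳ a) (*-zeroʳ b))
sum-degrees a b (zero ∷ L)
  rewrite sum-degrees (suc a) b L | choose-1 (length L) | length≡zeros+ones L =
  shuffle a b (zeros L) (ones L) ((zeros L + ones L) choose 2)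
  where
  shuffle : ∀ a b z o c → a + o + (suc a * z + b * o + c) ≡ a * suc z + b * o + (z + o + c)
  shuffle = solve-∀
sum-degrees a b (one ∷ L)
  rewrite sum-degrees a (suc b) L | choose-1 (length L) | length≡zeros+ones L =
  shuffle a b (zeros L) (ones L) ((zeros L + ones L) choose 2)
  where
  shuffle : ∀ a b z o c → b + z + (a * z + suc b * o + c) ≡ a * z + b * suc o + (z + o + c)
  shuffle = solve-∀

#monotone-lower : ∀ r (L : Bits) →
  length L * ⌊ pred (length L) /2⌋ choose suc r ≤ #monotone (suc (suc r)) L
#monotone-lower r L = begin
  length L * a choose suc r                 ≡⟨ cong (_* a choose suc r) (sym (length-degrees 0 0 L)) ⟩
  length (degrees 0 0 L) * a choose suc r   ≤⟨ choose-jensen a r (degrees 0 0 L) a·n≤Σdegrees ⟩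
  Σchoose (degrees 0 0 L) (suc r)           ≡⟨ sym (#monotone-formula r L) ⟩
  #monotone (suc (suc r)) L                 ∎
  where
  open ≤-Reasoning
  a = ⌊ pred (length L) /2⌋
  a·n≤nC2 : ∀ n → ⌊ pred n /2⌋ * n ≤ n choose 2
  a·n≤nC2 zero     = z≤n
  a·n≤nC2 (suc n') = *-cancelˡ-≤ 2 (begin
    2 * (⌊ n' /2⌋ * suc n')  ≡⟨ sym (*-assoc 2 ⌊ n' /2⌋ (suc n')) ⟩
    2 * ⌊ n' /2⌋ * suc n'    ≤⟨ *-monoˡ-≤ (suc n') (2*⌊n/2⌋≤n n') ⟩
    n' * suc n'              ≡⟨ *-comm n' (suc n') ⟩
    suc n' * n'              ≡⟨ cong (suc n' *_) (sym (choose-1 n')) ⟩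
    suc n' * n' choose 1     ≡⟨ sym (choose-absorb n' 1) ⟩
    2 * suc n' choose 2      ∎)
  a·n≤Σdegrees : a * length (degrees 0 0 L) ≤ sum (degrees 0 0 L)
  a·n≤Σdegrees rewrite length-degrees 0 0 L | sum-degrees 0 0 L = a·n≤nC2 (length L)

alternating : (n : ℕ) → Vec (Fin 2) n
alternating zero          = []
alternating (suc zero)    = zero ∷ []
alternating (suc (suc n)) = zero ∷ one ∷ alternating n

ones-alternating : ∀ n → ones (toList (alternating n)) ≡ ⌊ n /2⌋
ones-alternating zero          = refl
ones-alternating (suc zero)    = refl
ones-alternating (suc (suc n)) = cong suc (ones-alternating n)

zeros-alternating : ∀ n → zeros (toList (alternating n)) ≡ ⌈ n /2⌉
zeros-alternating zero          = refl
zeros-alternating (suc zero)    = refl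
zeros-alternating (suc (suc n)) = cong suc (zeros-alternating n)

degrees-alternating : ∀ n a K → a + ⌊ n /2⌋ ≤ K → All (_≤ K) (degrees a a (toList (alternating n)))
degrees-alternating zero          a K h = []
degrees-alternating (suc zero)    a K h = h ∷ []
degrees-alternating (suc (suc n)) a K h =
  subst (_≤ K) (cong (_+_ a) (sym (cong suc (ones-alternating n)))) h
  ∷ ≤-trans (≤-reflexive (cong (_+_ a) (zeros-alternating n))) (≤-trans (+-monoʳ-≤ a (⌈n/2⌉≤1+⌊n/2⌋ n)) h)
  ∷ degrees-alternating n (suc a) K (≤-trans (≤-reflexive (sym (+-suc a ⌊ n /2⌋))) h)

#monotone-alternating : ∀ r n → #monotone (suc (suc r)) (toList (alternating n)) ≤ n * ⌊ n /2⌋ choose suc r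
#monotone-alternating r n = begin
  #monotone (suc (suc r)) A                       ≡⟨ #monotone-formula r A ⟩
  Σchoose (degrees 0 0 A) (suc r)                 ≤⟨ Σchoose-≤ ⌊ n /2⌋ (suc r) (degrees 0 0 A) (degrees-alternating n 0 ⌊ n /2⌋ ≤-refl) ⟩
  length (degrees 0 0 A) * ⌊ n /2⌋ choose suc r   ≡⟨ cong (_* ⌊ n /2⌋ choose suc r) (trans (length-degrees 0 0 A) (length-toList (alternating n))) ⟩
  n * ⌊ n /2⌋ choose suc r                        ∎
  where
  open ≤-Reasoning
  A = toList (alternating n)

-- Rationals

toℚᵘ-/ : ∀ a b → toℚᵘ (+ a / suc b) ℚᵘ.≃ mkℚᵘ (+ a) b
toℚᵘ-/ a b = ℚP.toℚᵘ-fromℚᵘ (mkℚᵘ (+ a) b)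

ratio≡/ : ∀ a b .{{_ : NonZero b}} → ratio a b ≡ + a / b
ratio≡/ a (suc b) = refl

/-≤-/+1/ : ∀ a b c d e .{{_ : NonZero b}} .{{_ : NonZero d}} .{{_ : NonZero e}} →
           a * (d * e) ≤ (c * e + d) * b → + a / b ℚ.≤ + c / d ℚ.+ + 1 / e
/-≤-/+1/ a (suc b) c (suc d) (suc e) h = ℚP.toℚᵘ-cancel-≤ (begin
  toℚᵘ (+ a / suc b)                              ≃⟨ toℚᵘ-/ a b ⟩
  mkℚᵘ (+ a) b                                    ≤⟨ *≤* (subst₂ ℤ._≤_ (ℤP.pos-* a _) cross (ℤ.+≤+ h)) ⟩
  mkℚᵘ (+ c) d ℚᵘ.+ mkℚᵘ (+ 1) e                  ≃⟨ ℚᵘP.+-cong (ℚᵘP.≃-sym (toℚᵘ-/ c d)) (ℚᵘP.≃-sym (toℚᵘ-/ 1 e)) ⟩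
  toℚᵘ (+ c / suc d) ℚᵘ.+ toℚᵘ (+ 1 / suc e)     ≃⟨ ℚᵘP.≃-sym (ℚP.toℚᵘ-homo-+ (+ c / suc d) (+ 1 / suc e)) ⟩
  toℚᵘ (+ c / suc d ℚ.+ + 1 / suc e)             ∎)
  where
  open ℚᵘP.≤-Reasoning
  cross : + ((c * suc e + suc d) * suc b) ≡ (+ c ℤ.* + suc e ℤ.+ + 1 ℤ.* + suc d) ℤ.* + suc b
  cross = trans (ℤP.pos-* (c * suc e + suc d) (suc b))
                (cong (ℤ._* + suc b) (trans (ℤP.pos-+ (c * suc e) (suc d))
                                            (cong₂ ℤ._+_ (ℤP.pos-* c (suc e)) (sym (ℤP.*-identityˡ (+ suc d))))))
    where import Data.Integer.Properties as ℤP

∣p-q∣<ε : ∀ {p q δ ε} → p ℚ.≤ q ℚ.+ δ → q ℚ.≤ p ℚ.+ δ → δ ℚ.< ε → ∣ p ℚ.- q ∣ ℚ.< ε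
∣p-q∣<ε {p} {q} {δ} p≤q+δ q≤p+δ δ<ε with ℚP.∣p∣≡p∨∣p∣≡-p (p ℚ.- q)
... | inj₁ ∣p-q∣≡p-q rewrite ∣p-q∣≡p-q =
  ℚP.≤-<-trans (subst (p ℚ.- q ℚ.≤_) (xyx⁻¹≈y q δ) (ℚP.+-monoˡ-≤ (ℚ.- q) p≤q+δ)) δ<ε
... | inj₂ ∣p-q∣≡q-p rewrite ∣p-q∣≡q-p =
  ℚP.≤-<-trans (subst₂ ℚ._≤_ (sym (⁻¹-anti-homo‿- p q)) (xyx⁻¹≈y p δ) (ℚP.+-monoˡ-≤ (ℚ.- p) q≤p+δ)) δ<ε

minimumℚ-≤ : ∀ {y} xs → y ∈ xs → minimumℚ xs ℚ.≤ y
minimumℚ-≤ (x ∷ [])     (here refl)         = ℚP.≤-refl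
minimumℚ-≤ (x ∷ z ∷ zs) (here refl)         = ℚP.≤-trans (ℚP.p⊓q≤q z _) (minimumℚ-≤ (x ∷ zs) (here refl))
minimumℚ-≤ (x ∷ z ∷ zs) (there (here refl)) = ℚP.p⊓q≤p z _
minimumℚ-≤ (x ∷ z ∷ zs) (there (there y∈))  = ℚP.≤-trans (ℚP.p⊓q≤q z _) (minimumℚ-≤ (x ∷ zs) (there y∈))

minimumℚ-preserves : (P : ℚ → Set) → (∀ {p q} → P p → P q → P (p ℚ.⊓ q)) →
                     ∀ {y} xs → y ∈ xs → All P xs → P (minimumℚ xs)
minimumℚ-preserves P pres (x ∷ xs) _ (px ∷ pxs) = foldr-preservesᵇ pres px pxs

∈-allWords : ∀ {s} n (w : Word s n) → w ∈ allWords s n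
∈-allWords zero    []      = here refl
∈-allWords {s} (suc n) (a ∷ w) =
  ∈-concatMap⁺ (λ b → map (b ∷_) (allWords s n)) (Any.map (λ { refl → ∈-map⁺ (a ∷_) (∈-allWords n w) }) (∈-allFin a))

f-≤ : ∀ {s k n} (w : Word s n) → f s k n ℚ.≤ ratio (m k w) (n C k)
f-≤ {s} {k} {n} w = minimumℚ-≤ _ (∈-map⁺ (λ v → ratio (m k v) (n C k)) (∈-allWords n w))

≤-f+ : ∀ {s k n t δ} → (∀ (w : Word s n) → t ℚ.≤ ratio (m k w) (n C k) ℚ.+ δ) → Word s n →
       t ℚ.≤ f s k n ℚ.+ δ
≤-f+ {s} {k} {n} {t} {δ} t≤ratio+δ w =
  minimumℚ-preserves (λ x → t ℚ.≤ x ℚ.+ δ) (λ {p} {q} → ⊓-preserves {p} {q}) _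
    (∈-map⁺ g (∈-allWords n w)) (map⁺ (universal t≤ratio+δ _))
  where
  g : Word s n → ℚ
  g v = ratio (m k v) (n C k)
  ⊓-preserves : ∀ {p q} → t ℚ.≤ p ℚ.+ δ → t ℚ.≤ q ℚ.+ δ → t ℚ.≤ p ℚ.⊓ q ℚ.+ δ
  ⊓-preserves {p} {q} t≤p+δ t≤q+δ with ℚP.⊓-sel p q
  ... | inj₁ p⊓q≡p rewrite p⊓q≡p = t≤p+δ
  ... | inj₂ p⊓q≡q rewrite p⊓q≡q = t≤q+δ

1/suc<pos : ∀ ε → 0ℚ ℚ.< ε → ∃[ e ] + 1 / suc e ℚ.< ε
1/suc<pos (mkℚ +[1+ p ] q _) _ = suc q , ℚP.toℚᵘ-cancel-< (ℚᵘP.<-respˡ-≃ (ℚᵘP.≃-sym (toℚᵘ-/ 1 (suc q))) (*<* (ℤ.+<+ 1+q<[1+p][2+q])))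
  where
  1+q<[1+p][2+q] : suc (1 * suc q) ≤ suc p * suc (suc q)
  1+q<[1+p][2+q] = ≤-trans (s≤s (≤-reflexive (*-identityˡ (suc q)))) (m≤n*m (suc (suc q)) (suc p))
1/suc<pos (mkℚ (+ 0)      _ _) (ℚ.*<* (ℤ.+<+ ()))
1/suc<pos (mkℚ -[1+ _ ]   _ _) (ℚ.*<* ())

-- With D = n choose k, Q = 2 ^ R and e = E + 1, lower and upper say k/Q ≤ m/D + 1/e and
-- m/D ≤ k/Q + 1/e with the denominators cleared.
module Estimates (r E : ℕ) where
  R k e Q : ℕ
  R = suc r
  k = suc R
  e = suc E
  Q = 2 ^ R

  instance
    Q≢0 : NonZero Q
    Q≢0 = m^n≢0 2 R

  T δ : ℚ
  T = + k / Q
  δ = + 1 / e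

  -- Large enough that the error R (R + 1) / threshold of choose-halving-lower is at most 1 / (k e).
  threshold : ℕ
  threshold = k * (R * suc R) * e

  module _ (n' : ℕ) (large : threshold + R ≤ n') where
    n D B : ℕ
    n = suc n'
    D = n choose k
    B = n' choose R

    k·D≡n·B : k * D ≡ n * B
    k·D≡n·B = choose-absorb n' R

    k·e≤n' : k * e ≤ n'
    k·e≤n' = ≤-trans (*-monoˡ-≤ e (m≤m*n k (R * suc R))) (≤-trans (m≤m+n threshold R) large)

    instance
      n'≢0 : NonZero n'
      n'≢0 = >-nonZero (≤-trans (s≤s z≤n) k·e≤n')
      D≢0 : NonZero D
      D≢0 = >-nonZero (1≤choose {n} {k} (s≤s (≤-trans (m≤n+m R threshold) large)))

    halved-ratio-lower : k * B * e ≤ k * ⌊ n' /2⌋ choose R * e * Q + B * Q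
    halved-ratio-lower = *-cancelʳ-≤ (k * B * e) (k * H * e * Q + B * Q) threshold (begin
      k * B * e * Y                         ≡⟨ regroup k B e Y ⟩
      k * e * (B * Y)                       ≤⟨ *-monoʳ-≤ (k * e) weierstrass ⟩
      k * e * (Q * H * Y + B * (R * suc R)) ≡⟨ expand k e Q H Y B (R * suc R) ⟩
      k * H * e * Q * Y + B * Y             ≤⟨ +-monoʳ-≤ (k * H * e * Q * Y) (*-monoʳ-≤ B (m≤n*m Y Q)) ⟩
      k * H * e * Q * Y + B * (Q * Y)       ≡⟨ collect (k * H * e * Q) B Q Y ⟩
      (k * H * e * Q + B * Q) * Y           ∎)
      where
      open ≤-Reasoning
      H = ⌊ n' /2⌋ choose R
      Y = threshold
      weierstrass : B * Y ≤ Q * H * Y + B * (R * suc R)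
      weierstrass = choose-halving-lower R {⌊ n' /2⌋} {n'} {1} (2*⌊n/2⌋≤n n') (n≤2*⌊n/2⌋+1 n') large
      regroup : ∀ k B e Y → k * B * e * Y ≡ k * e * (B * Y)
      regroup = solve-∀
      expand : ∀ k e Q H Y B c → k * e * (Q * H * Y + B * c) ≡ k * H * e * Q * Y + B * (k * c * e)
      expand = solve-∀
      collect : ∀ a B Q Y → a * Y + B * (Q * Y) ≡ (a + B * Q) * Y
      collect = solve-∀

    halved-ratio-upper : k * e * (Q * ⌊ n /2⌋ choose R) ≤ (k * e + Q) * B
    halved-ratio-upper = *-cancelʳ-≤ (k * e * (Q * H)) ((k * e + Q) * B) n' (begin
      k * e * (Q * H) * n'          ≡⟨ *-assoc (k * e) (Q * H) n' ⟩
      k * e * (Q * H * n')          ≤⟨ *-monoʳ-≤ (k * e) (choose-halving-upper r {⌊ n /2⌋} (2*⌊n/2⌋≤n n)) ⟩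
      k * e * (B * n)               ≡⟨ expand (k * e) B n' ⟩
      k * e * B * n' + k * e * B    ≤⟨ +-monoʳ-≤ (k * e * B * n') (*-monoˡ-≤ B (≤-trans k·e≤n' (m≤n*m n' Q))) ⟩
      k * e * B * n' + Q * n' * B   ≡⟨ collect (k * e) Q B n' ⟩
      (k * e + Q) * B * n'          ∎)
      where
      open ≤-Reasoning
      H = ⌊ n /2⌋ choose R
      expand : ∀ a B n' → a * (B * suc n') ≡ a * B * n' + a * B
      expand = solve-∀
      collect : ∀ a Q B n' → a * B * n' + Q * n' * B ≡ (a + Q) * B * n'
      collect = solve-∀

    lower : ∀ m → n * ⌊ n' /2⌋ choose R ≤ m → k * (D * e) ≤ (m * e + D) * Q
    lower m n·H≤m = *-cancelˡ-≤ {k * (D * e)} {(m * e + D) * Q} k (begin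
      k * (k * (D * e))               ≡⟨ regroup k D e ⟩
      (k * D) * (k * e)               ≡⟨ cong (_* (k * e)) k·D≡n·B ⟩
      n * B * (k * e)                 ≡⟨ regroup′ n B k e ⟩
      n * (k * B * e)                 ≤⟨ *-monoʳ-≤ n halved-ratio-lower ⟩
      n * (k * H * e * Q + B * Q)     ≡⟨ expand n k H e Q B ⟩
      k * (n * H) * e * Q + n * B * Q ≤⟨ +-monoˡ-≤ (n * B * Q) (*-monoˡ-≤ Q (*-monoˡ-≤ e (*-monoʳ-≤ k n·H≤m))) ⟩
      k * m * e * Q + n * B * Q       ≡⟨ cong (λ z → k * m * e * Q + z * Q) (sym k·D≡n·B) ⟩
      k * m * e * Q + k * D * Q       ≡⟨ collect k m e Q D ⟩
      k * ((m * e + D) * Q)           ∎)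
      where
      open ≤-Reasoning
      H = ⌊ n' /2⌋ choose R
      regroup : ∀ k D e → k * (k * (D * e)) ≡ (k * D) * (k * e)
      regroup = solve-∀
      regroup′ : ∀ n B k e → n * B * (k * e) ≡ n * (k * B * e)
      regroup′ = solve-∀
      expand : ∀ n k H e Q B → n * (k * H * e * Q + B * Q) ≡ k * (n * H) * e * Q + n * B * Q
      expand = solve-∀
      collect : ∀ k m e Q D → k * m * e * Q + k * D * Q ≡ k * ((m * e + D) * Q)
      collect = solve-∀

    upper : ∀ m → m ≤ n * ⌊ n /2⌋ choose R → m * (Q * e) ≤ (k * e + Q) * D
    upper m m≤n·H = *-cancelˡ-≤ {m * (Q * e)} {(k * e + Q) * D} k (begin
      k * (m * (Q * e))             ≤⟨ *-monoʳ-≤ k (*-monoˡ-≤ (Q * e) m≤n·H) ⟩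
      k * (n * H * (Q * e))         ≡⟨ regroup k n H Q e ⟩
      n * (k * e * (Q * H))         ≤⟨ *-monoʳ-≤ n halved-ratio-upper ⟩
      n * ((k * e + Q) * B)         ≡⟨ x*[y*z]≡y*[x*z] n (k * e + Q) B ⟩
      (k * e + Q) * (n * B)         ≡⟨ cong ((k * e + Q) *_) (sym k·D≡n·B) ⟩
      (k * e + Q) * (k * D)         ≡⟨ x*[y*z]≡y*[x*z] (k * e + Q) k D ⟩
      k * ((k * e + Q) * D)         ∎)
      where
      open ≤-Reasoning
      H = ⌊ n /2⌋ choose R
      regroup : ∀ k n H Q e → k * (n * H * (Q * e)) ≡ n * (k * e * (Q * H))
      regroup = solve-∀

    ratio≡ : ∀ a → ratio a (n C k) ≡ + a / D
    ratio≡ a = trans (cong (ratio a) (sym (choose≡C n k))) (ratio≡/ a D)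

    T≤ratio+δ : ∀ (w : Word 2 n) → T ℚ.≤ ratio (m k w) (n C k) ℚ.+ δ
    T≤ratio+δ w = subst (λ x → T ℚ.≤ x ℚ.+ δ) (sym (ratio≡ (m k w)))
                        (/-≤-/+1/ k Q (m k w) D e (lower (m k w) n·H≤m))
      where
      n·H≤m : n * ⌊ n' /2⌋ choose R ≤ m k w
      n·H≤m = subst (λ l → l * ⌊ pred l /2⌋ choose R ≤ m k w) (length-toList w) (#monotone-lower r (toList w))

    ratio-alternating≤T+δ : ratio (m k (alternating n)) (n C k) ℚ.≤ T ℚ.+ δ
    ratio-alternating≤T+δ = subst (ℚ._≤ T ℚ.+ δ) (sym (ratio≡ (m k (alternating n))))
      (/-≤-/+1/ (m k (alternating n)) D k Q e (upper (m k (alternating n)) (#monotone-alternating r n)))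

theorem1p1 : (k : ℕ) → 2 ≤ k → (ε : ℚ) → 0ℚ < ε →
    ∃[ N ] ((n : ℕ) → N ≤ n →
      ∣ f 2 k n - _/_ (+ k) (2 ^ (k ∸ 1)) {{m^n≢0 2 (k ∸ 1)}} ∣ < ε)
theorem1p1 1 (s≤s ())
theorem1p1 (suc (suc r)) _ ε 0<ε with 1/suc<pos ε 0<ε
... | E , δ<ε = suc (threshold + R) , close
  where
  open Estimates r E
  close : (n : ℕ) → suc (threshold + R) ≤ n → ∣ f 2 k n - T ∣ < ε
  close (suc n') (s≤s large) =
    ∣p-q∣<ε (ℚP.≤-trans (f-≤ {k = k} (alternating (suc n'))) (ratio-alternating≤T+δ n' large))
            (≤-f+ {k = k} (T≤ratio+δ n' large) (alternating (suc n')))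
            δ<ε
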